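{- Let $0<\epsilon\leq\frac{1}{20}$, let $M=\frac{6}{\epsilon}$, and let $k\geq\frac{3}{\epsilon^2}$ be an integer. Let $G$ be a graph with $\Delta(G)\leq k$ whose square is not list $(k+1)$-colorable, but such that the square of every proper subgraph of $G$ is list $(k+1)$-colorable. Define $V_1$ and $T$ as below. Then: every vertex of $V_1$ has exactly one neighbor of degree at least $k-M$; $V_1$ is a stable set; and $V_1\cap T=\emptyset$.
   Context: Graphs are finite and simple; $d(v)$ is the degree of $v$. The square of $G$ is the graph on $V(G)$ where two distinct vertices are adjacent iff they are adjacent or have a common neighbor in $G$; the square of $H$ is list $(k+1)$-colorable if for every assignment of lists of $k+1$ colors to its vertices there is a proper coloring of the square with each vertex colored from its list. The set $V_1$ is built inductively (it is the smallest set closed under the following rule): a vertex $u$ with $d(u)\leq M-1$ belongs to $V_1$ if $u$ is adjacent to $d(u)-1$ vertices $v_1,\dots,v_{d(u)-1}$ of degree $2$ such that the other neighbors of $v_2,\dots,v_{d(u)-1}$ belong to $V_1$ while the other neighbor of $v_1$ has degree at most $M-1$ (and need not belong to $V_1$). $T$ is the set of vertices of degree $2$ both of whose neighbors belong to $V_1$.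
   Formalization: The parameter ε is taken in the rationals, so M and the lower bound on k are rational as well. -}

module Defs where

open import Data.Nat as ℕ using (ℕ; zero; suc)
open import Data.Bool using (Bool; true; false; if_then_else_)
open import Data.Fin using (Fin)
open import Data.List using (List; []; _∷_; length; map; allFin)
open import Data.Nat.ListAction using (sum)
open import Data.List.Relation.Unary.All using (All)
open import Data.List.Relation.Unary.Unique.Propositional using (Unique)
open import Data.List.Membership.Propositional using (_∈_)
open import Data.Product using (Σ; _×_; ∃; ∃-syntax)
open import Data.Sum using (_⊎_)
open import Data.Integer using (+_)
open import Data.Rational as ℚ using (ℚ; 0ℚ; _/_; >-nonZero; 1/_)
open import Relation.Binary.PropositionalEquality using (_≡_; _≢_)

record Graph : Set where
  field
    n      : ℕ
    adj    : Fin n → Fin n → Bool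
    sym    : ∀ u v → adj u v ≡ adj v u
    irrefl : ∀ v → adj v v ≡ false

⟦_⟧ : ℕ → ℚ
⟦ d ⟧ = (+ d) / 1

module _ (G : Graph) where
  open Graph G

  deg : Fin n → ℕ
  deg v = sum (map (λ u → if adj v u then 1 else 0) (allFin n))

  MaxDeg≤ : ℕ → Set
  MaxDeg≤ k = ∀ v → deg v ℕ.≤ k

  record IsSubgraph (VH : Fin n → Bool) (EH : Fin n → Fin n → Bool) : Set where
    field
      edge⊆  : ∀ u v → EH u v ≡ true → adj u v ≡ true
      ends   : ∀ u v → EH u v ≡ true → (VH u ≡ true × VH v ≡ true)
      symH   : ∀ u v → EH u v ≡ EH v u

  IsProper : (VH : Fin n → Bool) (EH : Fin n → Fin n → Bool) → Set
  IsProper VH EH = (∃[ v ] VH v ≡ false)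
                 ⊎ (∃[ u ] ∃[ v ] (adj u v ≡ true × EH u v ≡ false))

  SqAdj : (VH : Fin n → Bool) (EH : Fin n → Fin n → Bool) → Fin n → Fin n → Set
  SqAdj VH EH u v = u ≢ v × (EH u v ≡ true
                    ⊎ (∃[ w ] (VH w ≡ true × EH u w ≡ true × EH w v ≡ true)))

  SqListColorable : (VH : Fin n → Bool) (EH : Fin n → Fin n → Bool) → ℕ → Set
  SqListColorable VH EH k =
    (L : Fin n → List ℕ) →
    (∀ v → VH v ≡ true → (length (L v) ≡ suc k × Unique (L v))) →
    Σ (Fin n → ℕ) λ c →
      (∀ v → VH v ≡ true → c v ∈ L v) ×
      (∀ u v → VH u ≡ true → VH v ≡ true → SqAdj VH EH u v → c u ≢ c v)

  allV : Fin n → Bool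
  allV _ = true

  -- the set V₁, parametrised by the predicate "Low d" meaning d ≤ M - 1.
  -- Inductive definition = smallest set closed under the rule.
  data V₁ (Low : ℕ → Set) : Fin n → Set where
    mk : ∀ u →
         Low (deg u) →
         (v₁ : Fin n) (rest : List (Fin n)) →
         Unique (v₁ ∷ rest) →
         suc (length (v₁ ∷ rest)) ≡ deg u →
         All (λ v → adj u v ≡ true × deg v ≡ 2) (v₁ ∷ rest) →
         (∃[ w ] (adj v₁ w ≡ true × w ≢ u × Low (deg w))) →
         All (λ v → ∃[ w ] (adj v w ≡ true × w ≢ u × V₁ Low w)) rest →
         V₁ Low u

  Tset : (Low : ℕ → Set) → Fin n → Set
  Tset Low v = deg v ≡ 2 × (∀ w → adj v w ≡ true → V₁ Low w)

invε : (ε : ℚ) → 0ℚ ℚ.< ε → ℚ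
invε ε h = (1/ ε) {{>-nonZero h}}

Mval : (ε : ℚ) → 0ℚ ℚ.< ε → ℚ
Mval ε h = ⟦ 6 ⟧ ℚ.* invε ε h

module Submission where

-- Let u ∈ V₁ with degree-2 neighbours vs (|vs| = d(u) − 1), each with a
-- low-degree far end; u has exactly one further neighbour x.  If x were not
-- of high degree we could list-colour G²: colour G − u by minimality,
-- uncolour vs, colour u (it sees at most x, N(x) and the far ends:
-- d(x) + d(u) ≤ k vertices), then each t ∈ vs with far end w (it sees at
-- most u, w, N(u), N(w): 2 + d(u) + d(w) ≤ k vertices).  So the neighbours
-- of u are one high vertex plus pendant vertices, whose degree 2 is not
-- high; stability and V₁ ∩ T = ∅ follow by looking at degree-2 vertices.

open import Defs
open import Data.Nat as ℕ using (ℕ)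
open import Data.Bool using (Bool; true; false)
open import Data.Fin using (Fin)
open import Data.Product using (Σ; _×_; ∃; ∃-syntax)
open import Data.Rational as ℚ using (ℚ; 0ℚ; _/_; 1/_; >-nonZero)
open import Data.Integer using (+_)
open import Relation.Nullary using (¬_)
open import Relation.Binary.PropositionalEquality using (_≡_)

open import Data.Nat using (zero; suc; _+_; _≤_; _<_; z≤n; s≤s)
import Data.Nat.Properties as ℕP
open import Data.Nat.ListAction using (sum)
open import Data.Nat.Coprimality using (1-coprimeTo) renaming (sym to coprime-sym)
open import Data.Bool as Bool using (_∧_; not; if_then_else_)
open import Data.Bool.Properties using (∧-conicalˡ; ∧-conicalʳ; ∧-comm)
open import Data.Fin.Properties using (_≟_)
import Data.Integer as ℤ
import Data.Integer.Properties as ℤP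
import Data.Rational.Properties as ℚP
open import Data.Rational using (1ℚ; mkℚ; Positive; NonNegative; NonZero)
open import Data.Rational.Solver using (module +-*-Solver)
open import Data.List using (List; []; _∷_; length; map; allFin; filter; _++_)
open import Data.List.Properties using (length-map; length-++)
open import Data.List.Relation.Unary.All as All using (All; []; _∷_; all?)
open import Data.List.Relation.Unary.All.Properties using (¬All⇒Any¬; ¬Any⇒All¬)
open import Data.List.Relation.Unary.Any using (here; there)
open import Data.List.Relation.Unary.AllPairs using ([]; _∷_)
open import Data.List.Relation.Unary.Unique.Propositional using (Unique)
import Data.List.Relation.Unary.Unique.Propositional.Properties as Unique
open import Data.List.Relation.Binary.Subset.Propositional using (_⊆_)
open import Data.List.Membership.Propositional using (_∈_; _∉_; find)
open import Data.List.Membership.Propositional.Properties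
  using (∈-allFin; ∈-filter⁺; ∈-filter⁻; ∈-map⁺; ∈-++⁺ˡ; ∈-++⁺ʳ)
import Data.List.Membership.DecPropositional as DecMembership
open import Data.Product using (_,_; proj₁; proj₂)
open import Data.Sum using (_⊎_; inj₁; inj₂)
open import Data.Empty using (⊥-elim)
open import Data.Unit using (⊤; tt)
open import Relation.Nullary using (Dec; yes; no; does)
open import Relation.Binary.Definitions using (DecidableEquality)
open import Relation.Binary.PropositionalEquality
  using (_≢_; refl; sym; trans; cong; cong₂; subst; subst₂)

module _ {A : Set} where

  remove : ∀ {x : A} {ys} → x ∈ ys → List A
  remove {ys = _ ∷ ys} (here _)  = ys
  remove {ys = y ∷ _}  (there p) = y ∷ remove p

  length-remove : ∀ {x : A} {ys} (x∈ys : x ∈ ys) → length ys ≡ suc (length (remove x∈ys))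
  length-remove (here _)  = refl
  length-remove (there p) = cong suc (length-remove p)

  ∈-remove : ∀ {x y : A} {ys} (x∈ys : x ∈ ys) → y ∈ ys → y ≢ x → y ∈ remove x∈ys
  ∈-remove (here refl) (here y≡x)  y≢x = ⊥-elim (y≢x y≡x)
  ∈-remove (here refl) (there y∈)  y≢x = y∈
  ∈-remove (there p)   (here y≡z)  y≢x = here y≡z
  ∈-remove (there p)   (there y∈)  y≢x = there (∈-remove p y∈ y≢x)

  unique-⊆-length : ∀ {xs ys : List A} → Unique xs → xs ⊆ ys → length xs ≤ length ys
  unique-⊆-length {[]}     _            _     = z≤n
  unique-⊆-length {x ∷ xs} {ys} (x∉xs ∷ uxs) xs⊆ys =
    subst (suc (length xs) ≤_) (sym (length-remove x∈ys)) (s≤s (unique-⊆-length uxs xs⊆ys∖x))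
    where
      x∈ys : x ∈ ys
      x∈ys = xs⊆ys (here refl)
      xs⊆ys∖x : xs ⊆ remove x∈ys
      xs⊆ys∖x a∈xs = ∈-remove x∈ys (xs⊆ys (there a∈xs)) (λ a≡x → All.lookup x∉xs a∈xs (sym a≡x))

  module _ (_≟ᴬ_ : DecidableEquality A) where
    open DecMembership _≟ᴬ_ using (_∈?_)

    outside : ∀ {xs ys : List A} → Unique xs → length ys < length xs → ∃[ x ] (x ∈ xs × x ∉ ys)
    outside {xs} {ys} uxs ys<xs with all? (_∈? ys) xs
    ... | yes xs⊆ys = ⊥-elim (ℕP.<⇒≱ ys<xs (unique-⊆-length uxs (All.lookup xs⊆ys)))
    ... | no xs⊈ys  = find (¬All⇒Any¬ (_∈? ys) xs xs⊈ys)

  sum-indicator : (f : A → Bool) (xs : List A) →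
    sum (map (λ a → if f a then 1 else 0) xs) ≡ length (filter (λ a → f a Bool.≟ true) xs)
  sum-indicator f [] = refl
  sum-indicator f (x ∷ xs) with f x
  ... | true  = cong suc (sum-indicator f xs)
  ... | false = sum-indicator f xs

module Neighbourhoods (G : Graph) where
  open Graph G using (n; adj)

  nbrs : Fin n → List (Fin n)
  nbrs v = filter (λ u → adj v u Bool.≟ true) (allFin n)

  deg-nbrs : ∀ v → deg G v ≡ length (nbrs v)
  deg-nbrs v = sum-indicator (adj v) (allFin n)

  ∈nbrs⁺ : ∀ {v u} → adj v u ≡ true → u ∈ nbrs v
  ∈nbrs⁺ {v} {u} v~u = ∈-filter⁺ (λ u → adj v u Bool.≟ true) (∈-allFin u) v~u

  ∈nbrs⁻ : ∀ {v u} → u ∈ nbrs v → adj v u ≡ true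
  ∈nbrs⁻ {v} u∈ = proj₂ (∈-filter⁻ (λ u → adj v u Bool.≟ true) {xs = allFin n} u∈)

  nbrs-unique : ∀ v → Unique (nbrs v)
  nbrs-unique v = Unique.filter⁺ (λ u → adj v u Bool.≟ true) (Unique.allFin⁺ n)

  ≤deg : ∀ {v zs} → Unique zs → All (λ z → adj v z ≡ true) zs → length zs ≤ deg G v
  ≤deg {v} {zs} uzs v~zs =
    subst (length zs ≤_) (sym (deg-nbrs v)) (unique-⊆-length uzs (λ z∈ → ∈nbrs⁺ (All.lookup v~zs z∈)))

  adj-sym : ∀ {a b} → adj a b ≡ true → adj b a ≡ true
  adj-sym {a} {b} a~b = trans (sym (Graph.sym G a b)) a~b

  degree-two : ∀ {t a b y} → deg G t ≡ 2 → adj t a ≡ true → adj t b ≡ true → a ≢ b →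
               adj t y ≡ true → y ≡ a ⊎ y ≡ b
  degree-two {t} {a} {b} {y} d≡2 t~a t~b a≢b t~y with y ≟ a | y ≟ b
  ... | yes y≡a | _       = inj₁ y≡a
  ... | no _    | yes y≡b = inj₂ y≡b
  ... | no y≢a  | no y≢b  =
    ⊥-elim (ℕP.<⇒≱ (s≤s (s≤s (s≤s z≤n)))
      (subst (3 ≤_) d≡2 (≤deg ((y≢a ∷ y≢b ∷ []) ∷ (a≢b ∷ []) ∷ [] ∷ []) (t~y ∷ t~a ∷ t~b ∷ []))))

  module OneMoreNeighbour (u : Fin n) (vs : List (Fin n)) (uvs : Unique vs)
                          (|vs|+1≡deg : suc (length vs) ≡ deg G u) where

    one-more : ∃[ x ] (adj u x ≡ true × x ∉ vs)
    one-more with outside _≟_ (nbrs-unique u) (subst (length vs <_) (trans |vs|+1≡deg (deg-nbrs u)) ℕP.≤-refl)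
    ... | x , x∈nbrs , x∉vs = x , ∈nbrs⁻ x∈nbrs , x∉vs

    only-one-more : ∀ {x y} → All (λ v → adj u v ≡ true) vs →
                    adj u x ≡ true → x ∉ vs → adj u y ≡ true → y ∉ vs → y ≡ x
    only-one-more {x} {y} u~vs u~x x∉vs u~y y∉vs with y ≟ x
    ... | yes y≡x = y≡x
    ... | no y≢x  = ⊥-elim (ℕP.n≮n (suc (length vs)) (subst (suc (suc (length vs)) ≤_) (sym |vs|+1≡deg)
                      (≤deg ((y≢x ∷ ¬Any⇒All¬ vs y∉vs) ∷ ¬Any⇒All¬ vs x∉vs ∷ uvs) (u~y ∷ u~x ∷ u~vs))))

  SqA : Fin n → Fin n → Set
  SqA = SqAdj G (allV G) adj

  sq-sym : ∀ {a b} → SqA a b → SqA b a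
  sq-sym (a≢b , inj₁ a~b) = (λ b≡a → a≢b (sym b≡a)) , inj₁ (adj-sym a~b)
  sq-sym (a≢b , inj₂ (w , w∈ , a~w , w~b)) = (λ b≡a → a≢b (sym b≡a)) , inj₂ (w , w∈ , adj-sym w~b , adj-sym a~w)

module GreedyColouring (G : Graph) (k : ℕ) (L : Fin (Graph.n G) → List ℕ)
                       (L-ok : ∀ v → length (L v) ≡ suc k × Unique (L v)) where
  open Graph G using (n; adj)
  open Neighbourhoods G

  record PartialColouring (P : Fin n → Set) : Set where
    field
      colour    : Fin n → ℕ
      from-list : ∀ v → P v → colour v ∈ L v
      proper    : ∀ a b → P a → P b → SqA a b → colour a ≢ colour b

  restrict : ∀ {P Q : Fin n → Set} → PartialColouring P → (∀ a → Q a → P a) → PartialColouring Q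
  restrict c Q⊆P = record
    { colour    = colour
    ; from-list = λ v qv → from-list v (Q⊆P v qv)
    ; proper    = λ a b qa qb → proper a b (Q⊆P a qa) (Q⊆P b qb) }
    where open PartialColouring c

  extend : ∀ {P} → PartialColouring P → (s : Fin n) → ¬ P s →
           (forbidden : List (Fin n)) → length forbidden ≤ k →
           (∀ a → P a → SqA s a → a ∈ forbidden) →
           PartialColouring (λ a → P a ⊎ a ≡ s)
  extend {P} c s ¬Ps forbidden |F|≤k covers =
    record { colour = colour′ ; from-list = from-list′ ; proper = proper′ }
    where
      open PartialColouring c

      -- the list of s has k + 1 colours, at most k of them are forbidden
      free : ∃[ c₀ ] (c₀ ∈ L s × c₀ ∉ map colour forbidden)
      free = outside ℕP._≟_ (proj₂ (L-ok s))
        (subst₂ _<_ (sym (length-map colour forbidden)) (sym (proj₁ (L-ok s))) (s≤s |F|≤k))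

      c₀ : ℕ
      c₀ = proj₁ free

      colour′ : Fin n → ℕ
      colour′ a with a ≟ s
      ... | yes _ = c₀
      ... | no _  = colour a

      colour′-new : colour′ s ≡ c₀
      colour′-new with s ≟ s
      ... | yes _   = refl
      ... | no s≢s  = ⊥-elim (s≢s refl)

      colour′-old : ∀ {a} → P a → colour′ a ≡ colour a
      colour′-old {a} pa with a ≟ s
      ... | yes refl = ⊥-elim (¬Ps pa)
      ... | no _     = refl

      c₀-fresh : ∀ b → P b → SqA s b → c₀ ≢ colour b
      c₀-fresh b pb s≈b c₀≡ =
        proj₂ (proj₂ free) (subst (_∈ map colour forbidden) (sym c₀≡) (∈-map⁺ colour (covers b pb s≈b)))

      from-list′ : ∀ v → P v ⊎ v ≡ s → colour′ v ∈ L v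
      from-list′ v (inj₁ pv)   = subst (_∈ L v) (sym (colour′-old pv)) (from-list v pv)
      from-list′ v (inj₂ refl) = subst (_∈ L v) (sym colour′-new) (proj₁ (proj₂ free))

      proper′ : ∀ a b → P a ⊎ a ≡ s → P b ⊎ b ≡ s → SqA a b → colour′ a ≢ colour′ b
      proper′ a b (inj₂ refl) (inj₂ refl) a≈b = ⊥-elim (proj₁ a≈b refl)
      proper′ a b (inj₂ refl) (inj₁ pb) a≈b
        rewrite colour′-new | colour′-old pb = c₀-fresh b pb a≈b
      proper′ a b (inj₁ pa) (inj₂ refl) a≈b
        rewrite colour′-new | colour′-old pa = λ eq → c₀-fresh a pa (sq-sym a≈b) (sym eq)
      proper′ a b (inj₁ pa) (inj₁ pb) a≈b
        rewrite colour′-old pa | colour′-old pb = proper a b pa pb a≈b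

  total : PartialColouring (λ _ → ⊤) →
          Σ (Fin n → ℕ) λ c → (∀ v → allV G v ≡ true → c v ∈ L v)
                            × (∀ a b → allV G a ≡ true → allV G b ≡ true → SqA a b → c a ≢ c b)
  total c = colour , (λ v _ → from-list v tt) , (λ a b _ _ → proper a b tt tt)
    where open PartialColouring c

-- Degree thresholds: what the reduction argument needs of "low" and
-- "high" degrees relative to the maximum list size k + 1.
record DegreeThresholds (k : ℕ) : Set₁ where
  field
    Low High          : ℕ → Set
    high?             : ∀ d → Dec (High d)
    low-not-high      : ∀ {d d′} → Low d → d′ ≤ d → ¬ High d′
    low-plus-not-high : ∀ {d d′} → Low d → ¬ High d′ → suc (d + d′) ≤ k
    low-plus-low      : ∀ {d d′} → Low d → Low d′ → suc d + suc d′ ≤ k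

module RationalThresholds where
  open ℚP.≤-Reasoning
  open +-*-Solver using (solve; _:+_; _:-_; _:=_)

  ⟦⟧-normal : ∀ a → ⟦ a ⟧ ≡ mkℚ (+ a) 0 (coprime-sym (1-coprimeTo a))
  ⟦⟧-normal a = ℚP.normalize-coprime (coprime-sym (1-coprimeTo a))

  ⟦⟧-+ : ∀ a b → ⟦ a + b ⟧ ≡ ⟦ a ⟧ ℚ.+ ⟦ b ⟧
  ⟦⟧-+ a b rewrite ⟦⟧-normal a | ⟦⟧-normal b | ℕP.*-identityʳ a | ℕP.*-identityʳ b
                 | ℤP.+◃n≡+n a | ℤP.+◃n≡+n b = refl

  ⟦⟧-mono-≤ : ∀ {a b} → a ≤ b → ⟦ a ⟧ ℚ.≤ ⟦ b ⟧
  ⟦⟧-mono-≤ {a} {b} a≤b rewrite ⟦⟧-normal a | ⟦⟧-normal b =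
    ℚ.*≤* (subst₂ ℤ._≤_ (sym (ℤP.*-identityʳ (+ a))) (sym (ℤP.*-identityʳ (+ b))) (ℤ.+≤+ a≤b))

  ⟦⟧-mono-< : ∀ {a b} → a < b → ⟦ a ⟧ ℚ.< ⟦ b ⟧
  ⟦⟧-mono-< {a} {b} a<b rewrite ⟦⟧-normal a | ⟦⟧-normal b =
    ℚ.*<* (subst₂ ℤ._<_ (sym (ℤP.*-identityʳ (+ a))) (sym (ℤP.*-identityʳ (+ b))) (ℤ.+<+ a<b))

  ⟦⟧-cancel-≤ : ∀ {a b} → ⟦ a ⟧ ℚ.≤ ⟦ b ⟧ → a ≤ b
  ⟦⟧-cancel-≤ {a} {b} le rewrite ⟦⟧-normal a | ⟦⟧-normal b =
    ℤP.drop‿+≤+ (subst₂ ℤ._≤_ (ℤP.*-identityʳ (+ a)) (ℤP.*-identityʳ (+ b)) (ℚP.drop-*≤* le))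

  ≤-−⇒+≤ : ∀ {x y z} → x ℚ.≤ y ℚ.- z → x ℚ.+ z ℚ.≤ y
  ≤-−⇒+≤ {x} {y} {z} le =
    subst (x ℚ.+ z ℚ.≤_) (solve 2 (λ y z → (y :- z) :+ z := y) refl y z) (ℚP.+-monoˡ-≤ z le)

  −≤⇒≤+ : ∀ {x y z} → x ℚ.- z ℚ.≤ y → x ℚ.≤ y ℚ.+ z
  −≤⇒≤+ {x} {y} {z} le =
    subst (ℚ._≤ y ℚ.+ z) (solve 2 (λ x z → (x :- z) :+ z := x) refl x z) (ℚP.+-monoˡ-≤ z le)

  ≰−⇒+< : ∀ {x y z} → ¬ (x ℚ.- z ℚ.≤ y) → y ℚ.+ z ℚ.< x
  ≰−⇒+< {x} {y} {z} nle =
    subst (y ℚ.+ z ℚ.<_) (solve 2 (λ x z → (x :- z) :+ z := x) refl x z) (ℚP.+-monoˡ-< z (ℚP.≰⇒> nle))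

  +-cancelʳ-< : ∀ {x y} z → x ℚ.+ z ℚ.< y ℚ.+ z → x ℚ.< y
  +-cancelʳ-< {x} {y} z lt = subst₂ ℚ._<_ (cancel x) (cancel y) (ℚP.+-monoˡ-< (ℚ.- z) lt)
    where
      cancel : ∀ a → (a ℚ.+ z) ℚ.- z ≡ a
      cancel a = solve 2 (λ a z → (a :+ z) :- z := a) refl a z

  thresholds : (M : ℚ) (k : ℕ) → M ℚ.+ M ℚ.≤ ⟦ k ⟧ → DegreeThresholds k
  thresholds M k 2M≤k = record
    { Low               = Low
    ; High              = High
    ; high?             = λ d → ⟦ k ⟧ ℚ.- M ℚP.≤? ⟦ d ⟧
    ; low-not-high      = λ {d} {d′} → low-not-high {d} {d′}
    ; low-plus-not-high = λ {d} {d′} → low-plus-not-high {d} {d′}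
    ; low-plus-low      = λ {d} {d′} → low-plus-low {d} {d′} }
    where
      Low High : ℕ → Set
      Low d  = ⟦ d ⟧ ℚ.≤ M ℚ.- ⟦ 1 ⟧
      High d = ⟦ k ⟧ ℚ.- M ℚ.≤ ⟦ d ⟧

      low⇒≤M : ∀ {d} → Low d → ⟦ suc d ⟧ ℚ.≤ M
      low⇒≤M {d} low = subst (ℚ._≤ M) (sym (trans (cong ⟦_⟧ (ℕP.+-comm 1 d)) (⟦⟧-+ d 1))) (≤-−⇒+≤ low)

      low-not-high : ∀ {d d′} → Low d → d′ ≤ d → ¬ High d′
      low-not-high {d} {d′} low d′≤d high = ℚP.<-irrefl refl (begin-strict
        ⟦ k ⟧            ≤⟨ −≤⇒≤+ high ⟩
        ⟦ d′ ⟧ ℚ.+ M     ≤⟨ ℚP.+-monoˡ-≤ M (⟦⟧-mono-≤ d′≤d) ⟩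
        ⟦ d ⟧ ℚ.+ M      <⟨ ℚP.+-monoˡ-< M (⟦⟧-mono-< {d} {suc d} ℕP.≤-refl) ⟩
        ⟦ suc d ⟧ ℚ.+ M  ≤⟨ ℚP.+-monoˡ-≤ M (low⇒≤M {d} low) ⟩
        M ℚ.+ M          ≤⟨ 2M≤k ⟩
        ⟦ k ⟧            ∎)

      low-plus-not-high : ∀ {d d′} → Low d → ¬ High d′ → suc (d + d′) ≤ k
      low-plus-not-high {d} {d′} low ¬high = ⟦⟧-cancel-≤ (ℚP.<⇒≤ (+-cancelʳ-< M (begin-strict
        ⟦ suc d + d′ ⟧ ℚ.+ M          ≡⟨ cong (ℚ._+ M) (⟦⟧-+ (suc d) d′) ⟩
        (⟦ suc d ⟧ ℚ.+ ⟦ d′ ⟧) ℚ.+ M  ≡⟨ ℚP.+-assoc ⟦ suc d ⟧ ⟦ d′ ⟧ M ⟩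
        ⟦ suc d ⟧ ℚ.+ (⟦ d′ ⟧ ℚ.+ M)  <⟨ ℚP.+-mono-≤-< (low⇒≤M {d} low) (≰−⇒+< ¬high) ⟩
        M ℚ.+ ⟦ k ⟧                   ≡⟨ ℚP.+-comm M ⟦ k ⟧ ⟩
        ⟦ k ⟧ ℚ.+ M                   ∎)))

      low-plus-low : ∀ {d d′} → Low d → Low d′ → suc d + suc d′ ≤ k
      low-plus-low {d} {d′} low low′ = ⟦⟧-cancel-≤ (begin
        ⟦ suc d + suc d′ ⟧           ≡⟨ ⟦⟧-+ (suc d) (suc d′) ⟩
        ⟦ suc d ⟧ ℚ.+ ⟦ suc d′ ⟧     ≤⟨ ℚP.+-mono-≤ (low⇒≤M {d} low) (low⇒≤M {d′} low′) ⟩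
        M ℚ.+ M                      ≤⟨ 2M≤k ⟩
        ⟦ k ⟧                        ∎)

  twice-M≤3/ε² : (ε : ℚ) (ε>0 : 0ℚ ℚ.< ε) → ε ℚ.≤ (+ 1) / 20 →
                 Mval ε ε>0 ℚ.+ Mval ε ε>0 ℚ.≤ ⟦ 3 ⟧ ℚ.* (invε ε ε>0 ℚ.* invε ε ε>0)
  twice-M≤3/ε² ε ε>0 ε≤1/20 = begin
    ⟦ 6 ⟧ ℚ.* t ℚ.+ ⟦ 6 ⟧ ℚ.* t  ≡⟨ ℚP.*-distribʳ-+ t ⟦ 6 ⟧ ⟦ 6 ⟧ ⟨
    ⟦ 12 ⟧ ℚ.* t                 ≤⟨ ℚP.*-monoʳ-≤-nonNeg t (ℚP.*-monoˡ-≤-nonNeg ⟦ 3 ⟧ 4≤t) ⟩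
    (⟦ 3 ⟧ ℚ.* t) ℚ.* t          ≡⟨ ℚP.*-assoc ⟦ 3 ⟧ t t ⟩
    ⟦ 3 ⟧ ℚ.* (t ℚ.* t)          ∎
    where
      instance
        ε≢0 : NonZero ε
        ε≢0 = >-nonZero ε>0
        ε-pos : Positive ε
        ε-pos = ℚ.positive ε>0
      t : ℚ
      t = invε ε ε>0
      instance
        t-pos : Positive t
        t-pos = ℚP.1/pos⇒pos ε
        t-nonNeg : NonNegative t
        t-nonNeg = ℚP.pos⇒nonNeg t
      -- 1 = t ε ≤ t/20, hence 4 ≤ 20 ≤ t
      1≤t/20 : 1ℚ ℚ.≤ t ℚ.* ((+ 1) / 20)
      1≤t/20 = subst (ℚ._≤ t ℚ.* ((+ 1) / 20)) (ℚP.*-inverseˡ ε) (ℚP.*-monoˡ-≤-nonNeg t ε≤1/20)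
      4≤t : ⟦ 4 ⟧ ℚ.≤ t
      4≤t = begin
        ⟦ 4 ⟧                             ≤⟨ ⟦⟧-mono-≤ {4} {20} (ℕP.m≤m+n 4 16) ⟩
        ⟦ 20 ⟧                            ≤⟨ ℚP.*-monoʳ-≤-nonNeg ⟦ 20 ⟧ 1≤t/20 ⟩
        (t ℚ.* ((+ 1) / 20)) ℚ.* ⟦ 20 ⟧   ≡⟨ ℚP.*-assoc t ((+ 1) / 20) ⟦ 20 ⟧ ⟩
        t ℚ.* 1ℚ                          ≡⟨ ℚP.*-identityʳ t ⟩
        t                                 ∎

module Reduction {k : ℕ} (θ : DegreeThresholds k) (G : Graph)
                 (not-colourable : ¬ SqListColorable G (allV G) (Graph.adj G) k)
                 (minimal : ∀ VH EH → IsSubgraph G VH EH → IsProper G VH EH →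
                            SqListColorable G VH EH k) where
  open DegreeThresholds θ
  open Graph G using (n; adj)
  open Neighbourhoods G
  open DecMembership (_≟_ {n}) using (_∈?_)
  open ℕP.≤-Reasoning

  V₁-low : ∀ {w} → V₁ G Low w → Low (deg G w)
  V₁-low (mk _ low _ _ _ _ _ _ _) = low

  V₁-deg≥2 : ∀ {w} → V₁ G Low w → 2 ≤ deg G w
  V₁-deg≥2 (mk _ _ _ _ _ |vs|+1≡deg _ _ _) = subst (2 ≤_) |vs|+1≡deg (s≤s (s≤s z≤n))

  record Pendant (u t : Fin n) : Set where
    field
      u~t     : adj u t ≡ true
      deg-t≡2 : deg G t ≡ 2
      far     : Fin n
      t~far   : adj t far ≡ true
      far≢u   : far ≢ u
      far-low : Low (deg G far)

  pendant : ∀ {u t} → adj u t ≡ true × deg G t ≡ 2 →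
            ∃[ w ] (adj t w ≡ true × w ≢ u × Low (deg G w)) → Pendant u t
  pendant (u~t , d≡2) (w , t~w , w≢u , low) = record
    { u~t = u~t ; deg-t≡2 = d≡2 ; far = w ; t~far = t~w ; far≢u = w≢u ; far-low = low }

  pendants : ∀ {u v₁ rest} → All (λ v → adj u v ≡ true × deg G v ≡ 2) (v₁ ∷ rest) →
             ∃[ w ] (adj v₁ w ≡ true × w ≢ u × Low (deg G w)) →
             All (λ v → ∃[ w ] (adj v w ≡ true × w ≢ u × V₁ G Low w)) rest →
             All (Pendant u) (v₁ ∷ rest)
  pendants (deg₁ ∷ degs) far₁ fars = pendant deg₁ far₁ ∷ All.zipWith
    (λ (d , (w , t~w , w≢u , w∈V₁)) → pendant d (w , t~w , w≢u , V₁-low w∈V₁)) (degs , fars)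

  pendant-nbrs : ∀ {u t y} (p : Pendant u t) → adj t y ≡ true → y ≡ u ⊎ y ≡ Pendant.far p
  pendant-nbrs p = degree-two deg-t≡2 (adj-sym u~t) t~far (λ u≡far → far≢u (sym u≡far))
    where open Pendant p

  pendant-nbr-not-high : ∀ {u t h} → Low (deg G u) → Pendant u t → adj t h ≡ true → ¬ High (deg G h)
  pendant-nbr-not-high low-u p t~h with pendant-nbrs p t~h
  ... | inj₁ refl = low-not-high low-u ℕP.≤-refl
  ... | inj₂ refl = low-not-high (Pendant.far-low p) ℕP.≤-refl

  far-ends : ∀ {u ts} → All (Pendant u) ts → List (Fin n)
  far-ends []       = []
  far-ends (p ∷ ps) = Pendant.far p ∷ far-ends ps

  length-far-ends : ∀ {u ts} (ps : All (Pendant u) ts) → length (far-ends ps) ≡ length ts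
  length-far-ends []       = refl
  length-far-ends (_ ∷ ps) = cong suc (length-far-ends ps)

  ∈far-ends : ∀ {u ts t a} (ps : All (Pendant u) ts) → t ∈ ts → adj t a ≡ true → a ≢ u →
              a ∈ far-ends ps
  ∈far-ends (p ∷ _) (here refl) t~a a≢u with pendant-nbrs p t~a
  ... | inj₁ a≡u   = ⊥-elim (a≢u a≡u)
  ... | inj₂ a≡far = here a≡far
  ∈far-ends (_ ∷ ps) (there t∈ts) t~a a≢u = there (∈far-ends ps t∈ts t~a a≢u)

  module VertexDeletion (u : Fin n) where
    keep : Fin n → Bool
    keep a = not (does (a ≟ u))

    keep-≢ : ∀ {a} → a ≢ u → keep a ≡ true
    keep-≢ {a} a≢u with a ≟ u
    ... | yes a≡u = ⊥-elim (a≢u a≡u)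
    ... | no _    = refl

    keep-u : keep u ≡ false
    keep-u with u ≟ u
    ... | yes _   = refl
    ... | no u≢u  = ⊥-elim (u≢u refl)

    edge : Fin n → Fin n → Bool
    edge a b = adj a b ∧ (keep a ∧ keep b)

    edge-≢ : ∀ {a b} → adj a b ≡ true → a ≢ u → b ≢ u → edge a b ≡ true
    edge-≢ a~b a≢u b≢u = cong₂ _∧_ a~b (cong₂ _∧_ (keep-≢ a≢u) (keep-≢ b≢u))

    G−u-subgraph : IsSubgraph G keep edge
    G−u-subgraph = record
      { edge⊆ = λ a b e → ∧-conicalˡ (adj a b) _ e
      ; ends  = λ a b e → let kab = ∧-conicalʳ (adj a b) _ e
                          in ∧-conicalˡ (keep a) (keep b) kab , ∧-conicalʳ (keep a) (keep b) kab
      ; symH  = λ a b → cong₂ _∧_ (Graph.sym G a b) (∧-comm (keep a) (keep b)) }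

    G−u-proper : IsProper G keep edge
    G−u-proper = inj₁ (u , keep-u)

  -- A low vertex u whose neighbours are the pendant vertices vs plus one
  -- more vertex x: minimality forces x to have high degree.
  module Configuration (u : Fin n) (vs : List (Fin n)) (uvs : Unique vs)
                       (|vs|+1≡deg : suc (length vs) ≡ deg G u)
                       (pend : All (Pendant u) vs) (low-u : Low (deg G u)) where
    open OneMoreNeighbour u vs uvs |vs|+1≡deg
    open VertexDeletion u

    x : Fin n
    x = proj₁ one-more

    u~x : adj u x ≡ true
    u~x = proj₁ (proj₂ one-more)

    is-x : ∀ {y} → adj u y ≡ true → y ∉ vs → y ≡ x
    is-x = only-one-more (All.map Pendant.u~t pend) u~x (proj₂ (proj₂ one-more))

    neighbour-cases : ∀ {y} → adj u y ≡ true → y ≡ x ⊎ Pendant u y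
    neighbour-cases {y} u~y with y ∈? vs
    ... | yes y∈vs = inj₂ (All.lookup pend y∈vs)
    ... | no y∉vs  = inj₁ (is-x u~y y∉vs)

    -- the vertices that keep their colour from G − u
    Outside : Fin n → Set
    Outside a = a ≢ u × a ∉ vs

    -- among Outside vertices, square-adjacency in G does not use u
    -- (two neighbours of u outside vs are both x)
    square-G−u : ∀ {a b} → Outside a → Outside b → SqA a b → SqAdj G keep edge a b
    square-G−u (a≢u , _) (b≢u , _) (a≢b , inj₁ a~b) = a≢b , inj₁ (edge-≢ a~b a≢u b≢u)
    square-G−u (a≢u , a∉vs) (b≢u , b∉vs) (a≢b , inj₂ (w , _ , a~w , w~b)) with w ≟ u
    ... | yes refl = ⊥-elim (a≢b (trans (is-x (adj-sym a~w) a∉vs) (sym (is-x w~b b∉vs))))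
    ... | no w≢u   = a≢b , inj₂ (w , keep-≢ w≢u , edge-≢ a~w a≢u w≢u , edge-≢ w~b w≢u b≢u)

    module _ (L : Fin n → List ℕ) (L-ok : ∀ v → length (L v) ≡ suc k × Unique (L v)) where
      open GreedyColouring G k L L-ok

      colour-outside : PartialColouring Outside
      colour-outside = record
        { colour    = proj₁ colouring
        ; from-list = λ v (v≢u , _) → proj₁ (proj₂ colouring) v (keep-≢ v≢u)
        ; proper    = λ a b oa ob a≈b → proj₂ (proj₂ colouring) a b (keep-≢ (proj₁ oa))
                                          (keep-≢ (proj₁ ob)) (square-G−u oa ob a≈b) }
        where colouring = minimal keep edge G−u-subgraph G−u-proper L (λ v _ → L-ok v)

      -- u sees at most x, N(x) and the far ends: d(x) + d(u) ≤ k vertices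
      colour-centre : ¬ High (deg G x) → PartialColouring Outside → PartialColouring (_∉ vs)
      colour-centre x-not-high c =
        restrict (extend c u (λ o → proj₁ o refl) forbidden |forbidden|≤k covers) outside-or-u
        where
          forbidden : List (Fin n)
          forbidden = x ∷ nbrs x ++ far-ends pend

          |forbidden|≤k : length forbidden ≤ k
          |forbidden|≤k = begin
            suc (length (nbrs x ++ far-ends pend))          ≡⟨ cong suc (length-++ (nbrs x)) ⟩
            suc (length (nbrs x) + length (far-ends pend))  ≡⟨ cong suc (cong₂ _+_ (sym (deg-nbrs x))
                                                                 (length-far-ends pend)) ⟩
            suc (deg G x + length vs)                       ≤⟨ s≤s (ℕP.+-monoʳ-≤ (deg G x)
                                                                 (subst (length vs ≤_) |vs|+1≡deg (ℕP.n≤1+n _))) ⟩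
            suc (deg G x + deg G u)                         ≡⟨ cong suc (ℕP.+-comm (deg G x) (deg G u)) ⟩
            suc (deg G u + deg G x)                         ≤⟨ low-plus-not-high low-u x-not-high ⟩
            k                                               ∎

          covers : ∀ a → Outside a → SqA u a → a ∈ forbidden
          covers a (_ , a∉vs) (_ , inj₁ u~a) = here (is-x u~a a∉vs)
          covers a (a≢u , _) (_ , inj₂ (w , _ , u~w , w~a)) with w ∈? vs
          ... | yes w∈vs = there (∈-++⁺ʳ (nbrs x) (∈far-ends pend w∈vs w~a a≢u))
          ... | no w∉vs  = there (∈-++⁺ˡ (∈nbrs⁺ (subst (λ z → adj z a ≡ true) (is-x u~w w∉vs) w~a)))

          outside-or-u : ∀ a → a ∉ vs → Outside a ⊎ a ≡ u
          outside-or-u a a∉vs with a ≟ u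
          ... | yes a≡u = inj₂ a≡u
          ... | no a≢u  = inj₁ (a≢u , a∉vs)

      -- a pendant t with far end w sees at most u, w, N(u) and N(w):
      -- 2 + d(u) + d(w) ≤ k vertices
      colour-pendants : ∀ {ts} → All (Pendant u) ts → PartialColouring (_∉ ts) → PartialColouring (λ _ → ⊤)
      colour-pendants []       c = restrict c (λ _ _ ())
      colour-pendants {t ∷ ts} (p ∷ ps) c = colour-pendants ps
        (restrict (extend c t (λ t∉ → t∉ (here refl)) forbidden |forbidden|≤k covers) not-in-rest)
        where
          open Pendant p

          forbidden : List (Fin n)
          forbidden = u ∷ far ∷ nbrs u ++ nbrs far

          |forbidden|≤k : length forbidden ≤ k
          |forbidden|≤k = begin
            suc (suc (length (nbrs u ++ nbrs far)))           ≡⟨ cong (λ m → suc (suc m)) (length-++ (nbrs u)) ⟩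
            suc (suc (length (nbrs u) + length (nbrs far)))   ≡⟨ cong (λ m → suc (suc m))
                                                                   (cong₂ _+_ (sym (deg-nbrs u)) (sym (deg-nbrs far))) ⟩
            suc (suc (deg G u + deg G far))                   ≡⟨ cong suc (ℕP.+-suc (deg G u) (deg G far)) ⟨
            suc (deg G u) + suc (deg G far)                   ≤⟨ low-plus-low low-u far-low ⟩
            k                                                 ∎

          covers : ∀ a → a ∉ t ∷ ts → SqA t a → a ∈ forbidden
          covers a _ (_ , inj₁ t~a) with pendant-nbrs p t~a
          ... | inj₁ a≡u   = here a≡u
          ... | inj₂ a≡far = there (here a≡far)
          covers a _ (_ , inj₂ (w , _ , t~w , w~a)) with pendant-nbrs p t~w
          ... | inj₁ refl = there (there (∈-++⁺ˡ (∈nbrs⁺ w~a)))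
          ... | inj₂ refl = there (there (∈-++⁺ʳ (nbrs u) (∈nbrs⁺ w~a)))

          not-in-rest : ∀ a → a ∉ ts → (a ∉ t ∷ ts) ⊎ a ≡ t
          not-in-rest a a∉ts with a ≟ t
          ... | yes a≡t = inj₂ a≡t
          ... | no a≢t  = inj₁ λ { (here a≡t) → a≢t a≡t ; (there a∈ts) → a∉ts a∈ts }

    -- otherwise the three steps above list-colour G²
    x-high : High (deg G x)
    x-high with high? (deg G x)
    ... | yes high  = high
    ... | no ¬high = ⊥-elim (not-colourable λ L L-ok →
          let L-ok′ = λ v → L-ok v refl
          in GreedyColouring.total G k L L-ok′
               (colour-pendants L L-ok′ pend (colour-centre L L-ok′ ¬high (colour-outside L L-ok′))))

  V₁-neighbours : ∀ {u} → V₁ G Low u →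
                  ∃[ x ] (adj u x ≡ true × High (deg G x) × (∀ {y} → adj u y ≡ true → y ≡ x ⊎ Pendant u y))
  V₁-neighbours {u} (mk _ low-u v₁ rest uvs |vs|+1≡deg degs far₁ fars) = x , u~x , x-high , neighbour-cases
    where open Configuration u (v₁ ∷ rest) uvs |vs|+1≡deg (pendants degs far₁ fars) low-u

  -- first claim: the other neighbours of u have degree 2 ≤ d(u), hence are not high
  unique-high-neighbour : ∀ u → V₁ G Low u →
    ∃[ w ] (adj u w ≡ true × High (deg G w) × (∀ w′ → adj u w′ ≡ true → High (deg G w′) → w′ ≡ w))
  unique-high-neighbour u u∈V₁ with V₁-neighbours u∈V₁
  ... | x , u~x , x-high , cases = x , u~x , x-high , only-x
    where
      only-x : ∀ w′ → adj u w′ ≡ true → High (deg G w′) → w′ ≡ x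
      only-x w′ u~w′ high with cases u~w′
      ... | inj₁ w′≡x = w′≡x
      ... | inj₂ p    = ⊥-elim (low-not-high (V₁-low u∈V₁) (V₁-deg≥2 u∈V₁)
                                  (subst High (Pendant.deg-t≡2 p) high))

  -- an adjacent V₁ vertex v would be either the high neighbour of u (but v
  -- is low) or a pendant vertex (but v has a high neighbour)
  V₁-stable : ∀ u v → V₁ G Low u → V₁ G Low v → adj u v ≡ false
  V₁-stable u v u∈V₁ v∈V₁ with adj u v in u~v
  ... | false = refl
  ... | true with V₁-neighbours u∈V₁ | V₁-neighbours v∈V₁
  ...   | x , _ , x-high , cases | h , v~h , h-high , _ with cases u~v
  ...     | inj₁ refl = ⊥-elim (low-not-high (V₁-low v∈V₁) ℕP.≤-refl x-high)
  ...     | inj₂ p    = ⊥-elim (pendant-nbr-not-high (V₁-low u∈V₁) p v~h h-high)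

  -- a V₁ vertex in T would be adjacent to its first pendant vertex, which T puts in V₁
  V₁-disjoint-T : ∀ v → V₁ G Low v → ¬ Tset G Low v
  V₁-disjoint-T v v∈V₁@(mk _ _ v₁ _ _ _ ((v~v₁ , _) ∷ _) _ _) (_ , nbrs∈V₁)
    with trans (sym v~v₁) (V₁-stable v v₁ v∈V₁ (nbrs∈V₁ v₁ v~v₁))
  ... | ()

lemma3 : (ε : ℚ) (ε>0 : 0ℚ ℚ.< ε) → ε ℚ.≤ (+ 1) / 20 →
         (k : ℕ) → ⟦ 3 ⟧ ℚ.* (invε ε ε>0 ℚ.* invε ε ε>0) ℚ.≤ ⟦ k ⟧ →
         (G : Graph) → MaxDeg≤ G k →
         ¬ SqListColorable G (allV G) (Graph.adj G) k →
         (∀ VH EH → IsSubgraph G VH EH → IsProper G VH EH → SqListColorable G VH EH k) →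
         let M = Mval ε ε>0
             Low = λ (d : ℕ) → ⟦ d ⟧ ℚ.≤ M ℚ.- ⟦ 1 ⟧
             High = λ (d : ℕ) → ⟦ k ⟧ ℚ.- M ℚ.≤ ⟦ d ⟧
             adj = Graph.adj G
         in (∀ u → V₁ G Low u →
               ∃[ w ] (adj u w ≡ true × High (deg G w)
                       × (∀ w′ → adj u w′ ≡ true → High (deg G w′) → w′ ≡ w)))
          × (∀ u v → V₁ G Low u → V₁ G Low v → adj u v ≡ false)
          × (∀ v → V₁ G Low v → ¬ Tset G Low v)
lemma3 ε ε>0 ε≤1/20 k 3/ε²≤k G _ not-colourable minimal =
  unique-high-neighbour , V₁-stable , V₁-disjoint-T
  where
    open RationalThresholds using (thresholds; twice-M≤3/ε²)
    M+M≤k = ℚP.≤-trans (twice-M≤3/ε² ε ε>0 ε≤1/20) 3/ε²≤k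
    open Reduction (thresholds (Mval ε ε>0) k M+M≤k) G not-colourable minimal
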